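{- Let $\phi=(1+\sqrt5)/2$ and let $F_1=F_2=1$, $F_{i+1}=F_i+F_{i-1}$. For integers $n\ge 0$ and $k\ge 1$ let $$C_k(n)=\lfloor (n+1)\phi\rfloor F_{k+1}+nF_k$$ be the entry in row $n$ and column $k$ of the Wythoff array. For an integer $m\ge 0$ with Zeckendorf representation $m=\sum_{i=2}^{r} a_iF_i$ ($a_i\in\{0,1\}$, $a_ia_{i+1}=0$; empty sum for $m=0$), define the fibbinary number $\mathrm{fib}(m)=\sum_{i=2}^{r}a_i2^{i-2}$ (so $\mathrm{fib}(0)=0$), and define $\mathrm{odfib}(n)=4\,\mathrm{fib}(n)+1$. Then for all $n\ge 0$ and $k\ge1$, $$\mathrm{fib}(C_k(n))=2^{k-1}\,\mathrm{odfib}(n)=2^{k-1}\bigl(4\,\mathrm{fib}(n)+1\bigr).$$ Equivalently, the map $m\mapsto \mathrm{fib}(m)$ sends the Wythoff array entrywise onto the fibbinary array whose $(n,k)$ entry is $2^{k-1}\mathrm{odfib}(n)$.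
   Context: Zeckendorf's theorem: every positive integer has a unique representation as a sum of non-consecutive Fibonacci numbers $F_i$, $i\ge 2$. The map $m\mapsto\mathrm{fib}(m)$ reads the Zeckendorf digit string of $m$ as a binary numeral; it is a bijection from the positive integers onto the positive integers whose binary expansion has no two adjacent 1s (the fibbinary numbers). -}

module Defs where

open import Data.Nat using (ℕ; zero; suc; _+_; _*_; _∸_; _^_; _≤_)
open import Data.Bool using (Bool; true; false; if_then_else_)
open import Data.List using (List; []; _∷_)
open import Data.Sum using (_⊎_)
open import Data.Product using (_×_)
open import Data.Empty using (⊥)
open import Relation.Binary.PropositionalEquality using (_≡_)

F : ℕ → ℕ
F zero = 0
F (suc zero) = 1
F (suc (suc n)) = F (suc n) + F n

-- Real inequality  a ≤ m·φ  with φ = (1+√5)/2, written out exactly: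
-- a ≤ m(1+√5)/2  ⇔  2a − m ≤ m√5  ⇔  2a ≤ m  or  (2a − m)² ≤ 5m²  (when 2a > m).
_≤φ*_ : ℕ → ℕ → Set
a ≤φ* m = (2 * a ≤ m) ⊎ ((2 * a ∸ m) * (2 * a ∸ m) ≤ 5 * (m * m))

IsFloorPhiMul : ℕ → ℕ → Set
IsFloorPhiMul m a = (a ≤φ* m) × ((suc a ≤φ* m) → ⊥)

-- Wythoff array entry C_k(n) = ⌊(n+1)φ⌋ F_{k+1} + n F_k, given a = ⌊(n+1)φ⌋.
wythoffEntry : (a n k : ℕ) → ℕ
wythoffEntry a n k = a * F (suc k) + n * F k

-- Digit strings: the list (a_2, a_3, …, a_r) of Zeckendorf digits, head = a_2.
NoAdjacentOnes : List Bool → Set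
NoAdjacentOnes [] = Data.Unit.⊤
  where import Data.Unit
NoAdjacentOnes (true ∷ true ∷ bs) = ⊥
NoAdjacentOnes (b ∷ bs) = NoAdjacentOnes bs

bit : Bool → ℕ
bit true = 1
bit false = 0

zvalFrom : ℕ → List Bool → ℕ
zvalFrom i [] = 0
zvalFrom i (b ∷ bs) = bit b * F i + zvalFrom (suc i) bs

zval : List Bool → ℕ
zval = zvalFrom 2

bval : List Bool → ℕ
bval [] = 0
bval (b ∷ bs) = bit b + 2 * bval bs

IsZeckendorf : ℕ → List Bool → Set
IsZeckendorf m ds = NoAdjacentOnes ds × (zval ds ≡ m)

-- Let e be the Zeckendorf digits of n.  Shifting every digit up one place multiplies
-- by φ up to a bounded error, and this error is small enough to give
-- ⌊(n + 1)φ⌋ = 1 + (value of the shifted digits 0e).  Hence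
-- C_k(n) = ⌊(n + 1)φ⌋F_{k+1} + nF_k has the digits 0^{k-1} 1 0 e, whose binary value is
-- 2^{k-1}(4 fib(n) + 1).  It remains to know that Zeckendorf digits are unique, which
-- is shown from the lowest digit up: the values of the digits read from F_2 and from
-- F_3 determine those read from F_1 and F_0 by the Fibonacci recurrence, and the
-- lowest digit is 1 exactly when these last two values (each plus one) have ratio > φ.
module Submission where

open import Defs
open import Data.Nat using (ℕ; suc; _+_; _*_; _∸_; _^_; _≤_)
open import Data.List using (List)
open import Data.Bool using (Bool)
open import Relation.Binary.PropositionalEquality using (_≡_)

open import Data.Nat using (_<_; _≤?_; _<?_; z≤n; s≤s)
open import Data.Nat.Properties
open import Data.Nat.Tactic.RingSolver using (solve-∀)
open import Data.List using ([]; _∷_; replicate; _++_)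
open import Data.Bool using (true; false)
open import Data.Product using (Σ; _×_; _,_; proj₂; uncurry)
open import Data.Sum using (inj₁; inj₂; [_,_])
open import Data.Empty using (⊥-elim)
open import Relation.Nullary using (¬_; yes; no)
open import Relation.Binary.PropositionalEquality
  using (refl; sym; trans; cong; cong₂; subst; subst₂; module ≡-Reasoning)

-- Since φ² = φ + 1:  a <φ* b  ⇔  a < bφ,  and  a >φ* b  ⇔  a > bφ.
infix 4 _<φ*_ _>φ*_

_<φ*_ : ℕ → ℕ → Set
a <φ* b = a * a < a * b + b * b

_>φ*_ : ℕ → ℕ → Set
a >φ* b = a * b + b * b < a * a

<-balance : ∀ {a b c d} → a < b → d + a ≡ b + c → c < d
<-balance {a} {b} {c} {d} a<b eq = +-cancelʳ-< a c d (begin-strict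
  c + a  <⟨ +-monoʳ-< c a<b ⟩
  c + b  ≡⟨ +-comm c b ⟩
  b + c  ≡⟨ sym eq ⟩
  d + a  ∎)
  where open ≤-Reasoning

-- x/y ↦ (x + y)/x = 1 + y/x reverses the order relative to its fixed point φ.
<φ*-flip : ∀ x y → x <φ* y → x + y >φ* x
<φ*-flip x y h = <-balance h (expand x y)
  where
  expand : ∀ x y → (x + y) * (x + y) + x * x ≡ (x * y + y * y) + ((x + y) * x + x * x)
  expand = solve-∀

>φ*-flip : ∀ x y → x >φ* y → x + y <φ* x
>φ*-flip x y h = <-balance h (expand x y)
  where
  expand : ∀ x y → ((x + y) * x + x * x) + (x * y + y * y) ≡ x * x + (x + y) * (x + y)
  expand = solve-∀

>φ*⇒> : ∀ {a b} → a >φ* b → b < a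
>φ*⇒> {a} {b} h = ≰⇒> λ a≤b → <⇒≱ h (begin
  a * a          ≤⟨ *-monoʳ-≤ a a≤b ⟩
  a * b          ≤⟨ m≤m+n (a * b) (b * b) ⟩
  a * b + b * b  ∎)
  where open ≤-Reasoning

square-suc : ∀ a → suc a * suc a ≡ a * a + (a + suc a)
square-suc = solve-∀

φ*-form-suc : ∀ a b → suc a * b + b * b ≡ (a * b + b * b) + b
φ*-form-suc = solve-∀

>φ*-suc : ∀ a b → a >φ* b → suc a >φ* b
>φ*-suc a b h = begin-strict
  suc a * b + b * b      ≡⟨ φ*-form-suc a b ⟩
  (a * b + b * b) + b    <⟨ +-mono-<-≤ h (≤-trans (<⇒≤ (>φ*⇒> h)) (m≤m+n a (suc a))) ⟩
  a * a + (a + suc a)    ≡⟨ square-suc a ⟨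
  suc a * suc a          ∎
  where open ≤-Reasoning

<φ*-pred : ∀ a b → suc a <φ* b → a <φ* b
<φ*-pred a b h with a <? b
... | yes a<b = begin-strict
  a * a          ≤⟨ *-monoʳ-≤ a (<⇒≤ a<b) ⟩
  a * b          <⟨ m<m+n (a * b) (*-mono-< (≤-<-trans z≤n a<b) (≤-<-trans z≤n a<b)) ⟩
  a * b + b * b  ∎
  where open ≤-Reasoning
... | no a≮b = +-cancelʳ-< b (a * a) (a * b + b * b) (begin-strict
  a * a + b              ≤⟨ +-monoʳ-≤ (a * a) (≤-trans (≮⇒≥ a≮b) (m≤m+n a (suc a))) ⟩
  a * a + (a + suc a)    ≡⟨ square-suc a ⟨
  suc a * suc a          <⟨ h ⟩
  suc a * b + b * b      ≡⟨ φ*-form-suc a b ⟩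
  (a * b + b * b) + b    ∎)
  where open ≤-Reasoning

-- With t = 2a − m ≥ 0 this compares 4·(a² vs am + m²) with t² vs 5m², the form used by _≤φ*_.
φ*-gap : ∀ a m t → t + m ≡ 2 * a → 5 * (m * m) + 4 * (a * a) ≡ 4 * (a * m + m * m) + t * t
φ*-gap a m t t+m≡2a = begin
  5 * (m * m) + 4 * (a * a)                    ≡⟨ cong (5 * (m * m) +_) (double-square a) ⟩
  5 * (m * m) + (2 * a) * (2 * a)              ≡⟨ cong (λ s → 5 * (m * m) + s * s) (sym t+m≡2a) ⟩
  5 * (m * m) + (t + m) * (t + m)              ≡⟨ expand t m ⟩
  2 * ((t + m) * m) + 4 * (m * m) + t * t      ≡⟨ cong (λ s → 2 * (s * m) + 4 * (m * m) + t * t) t+m≡2a ⟩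
  2 * ((2 * a) * m) + 4 * (m * m) + t * t      ≡⟨ cong (_+ t * t) (regroup a m) ⟩
  4 * (a * m + m * m) + t * t                  ∎
  where
  open ≡-Reasoning
  double-square : ∀ a → 4 * (a * a) ≡ (2 * a) * (2 * a)
  double-square = solve-∀
  expand : ∀ t m → 5 * (m * m) + (t + m) * (t + m) ≡ 2 * ((t + m) * m) + 4 * (m * m) + t * t
  expand = solve-∀
  regroup : ∀ a m → 2 * ((2 * a) * m) + 4 * (m * m) ≡ 4 * (a * m + m * m)
  regroup = solve-∀

<φ*⇒≤φ* : ∀ {a m} → a <φ* m → a ≤φ* m
<φ*⇒≤φ* {a} {m} h with 2 * a ≤? m
... | yes 2a≤m = inj₁ 2a≤m
... | no 2a≰m  = inj₂ (<⇒≤ (<-balance (*-monoʳ-< 4 h) (φ*-gap a m _ (m∸n+n≡m (<⇒≤ (≰⇒> 2a≰m))))))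

>φ*⇒≰φ* : ∀ {a m} → a >φ* m → ¬ (a ≤φ* m)
>φ*⇒≰φ* {a} {m} h = [ <⇒≱ m<2a , <⇒≱ (<-balance (*-monoʳ-< 4 h) gap) ]
  where
  m<2a : m < 2 * a
  m<2a = ≤-trans (>φ*⇒> h) (m≤m+n a (a + 0))
  t = 2 * a ∸ m
  gap : t * t + 4 * (a * m + m * m) ≡ 4 * (a * a) + 5 * (m * m)
  gap = trans (+-comm (t * t) _)
          (trans (sym (φ*-gap a m t (m∸n+n≡m (<⇒≤ m<2a)))) (+-comm (5 * (m * m)) _))

≤φ*-antimono : ∀ {a b m} → a ≤ b → b ≤φ* m → a ≤φ* m
≤φ*-antimono a≤b (inj₁ 2b≤m) = inj₁ (≤-trans (*-monoʳ-≤ 2 a≤b) 2b≤m)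
≤φ*-antimono {m = m} a≤b (inj₂ gap≤) = inj₂ (≤-trans (*-mono-≤ gap-mono gap-mono) gap≤)
  where gap-mono = ∸-monoˡ-≤ m (*-monoʳ-≤ 2 a≤b)

isFloorPhiMul-unique : ∀ {m a b} → IsFloorPhiMul m a → IsFloorPhiMul m b → a ≡ b
isFloorPhiMul-unique {m} (a≤ , sa≰) (b≤ , sb≰) = ≤-antisym (below a≤ sb≰) (below b≤ sa≰)
  where
  below : ∀ {a b} → a ≤φ* m → ¬ (suc b ≤φ* m) → a ≤ b
  below a≤ sb≰ = ≮⇒≥ λ b<a → sb≰ (≤φ*-antimono b<a a≤)

φ*-bracket⇒isFloorPhiMul : ∀ m b → b <φ* m → suc b >φ* m → IsFloorPhiMul m b
φ*-bracket⇒isFloorPhiMul m b b< sb> = <φ*⇒≤φ* {b} {m} b< , >φ*⇒≰φ* {suc b} {m} sb>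

zvalFrom-fib : ∀ i r → zvalFrom (2 + i) r ≡ zvalFrom (1 + i) r + zvalFrom i r
zvalFrom-fib i [] = refl
zvalFrom-fib i (b ∷ r) = trans (cong (bit b * (F (suc i) + F i) +_) (zvalFrom-fib (suc i) r))
  (distrib (bit b) (F (suc i)) (F i) (zvalFrom (2 + i) r) (zvalFrom (1 + i) r))
  where
  distrib : ∀ d p q x y → d * (p + q) + (x + y) ≡ (d * p + x) + (d * q + y)
  distrib = solve-∀

zvalFrom-≡-down : ∀ i r r' → zvalFrom (2 + i) r ≡ zvalFrom (2 + i) r' →
  zvalFrom (1 + i) r ≡ zvalFrom (1 + i) r' → zvalFrom i r ≡ zvalFrom i r'
zvalFrom-≡-down i r r' e₂ e₁ = +-cancelˡ-≡ (zvalFrom (1 + i) r') _ _ (begin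
  zvalFrom (1 + i) r' + zvalFrom i r  ≡⟨ cong (_+ zvalFrom i r) (sym e₁) ⟩
  zvalFrom (1 + i) r + zvalFrom i r   ≡⟨ sym (zvalFrom-fib i r) ⟩
  zvalFrom (2 + i) r                  ≡⟨ e₂ ⟩
  zvalFrom (2 + i) r'                 ≡⟨ zvalFrom-fib i r' ⟩
  zvalFrom (1 + i) r' + zvalFrom i r' ∎)
  where open ≡-Reasoning

zvalFrom-shift : ∀ s i r → zvalFrom (s + suc i) r ≡ F (suc s) * zvalFrom (suc i) r + F s * zvalFrom i r
zvalFrom-shift 0 i r = sym (trans (+-identityʳ _) (+-identityʳ _))
zvalFrom-shift 1 i r = trans (zvalFrom-fib i r)
  (sym (cong₂ _+_ (*-identityˡ (zvalFrom (suc i) r)) (*-identityˡ (zvalFrom i r))))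
zvalFrom-shift (suc (suc s)) i r = begin
  zvalFrom (suc (suc s) + suc i) r
    ≡⟨ zvalFrom-fib (s + suc i) r ⟩
  zvalFrom (suc s + suc i) r + zvalFrom (s + suc i) r
    ≡⟨ cong₂ _+_ (zvalFrom-shift (suc s) i r) (zvalFrom-shift s i r) ⟩
  (F (2 + s) * x + F (suc s) * y) + (F (suc s) * x + F s * y)
    ≡⟨ regroup (F (suc s)) (F s) x y ⟩
  F (3 + s) * x + F (2 + s) * y
    ∎
  where
  open ≡-Reasoning
  x = zvalFrom (suc i) r
  y = zvalFrom i r
  regroup : ∀ b c x y → ((b + c) * x + b * y) + (b * x + c * y) ≡ ((b + c) + b) * x + (b + c) * y
  regroup = solve-∀

PhiBounds : ℕ → ℕ → Set
PhiBounds x y = suc x >φ* y × x <φ* suc y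

phiBounds-next : ∀ x y → PhiBounds x y → suc (x + y) >φ* x × suc (x + y) <φ* suc x
phiBounds-next x y (lo , hi) = subst (_>φ* x) (+-suc x y) (<φ*-flip x (suc y) hi) , >φ*-flip (suc x) y lo

zvalFrom-phiBounds : ∀ r → PhiBounds (zvalFrom 1 r) (zvalFrom 0 r)
zvalFrom₂-phiBounds : ∀ r → suc (zvalFrom 2 r) >φ* zvalFrom 1 r × suc (zvalFrom 2 r) <φ* suc (zvalFrom 1 r)

zvalFrom-phiBounds [] = s≤s z≤n , s≤s z≤n
zvalFrom-phiBounds (false ∷ r) = lo , <φ*-pred (zvalFrom 2 r) (suc (zvalFrom 1 r)) hi
  where open Σ (zvalFrom₂-phiBounds r) renaming (proj₁ to lo; proj₂ to hi)
zvalFrom-phiBounds (true ∷ r) = >φ*-suc (suc (zvalFrom 2 r)) (zvalFrom 1 r) lo , hi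
  where open Σ (zvalFrom₂-phiBounds r) renaming (proj₁ to lo; proj₂ to hi)

zvalFrom₂-phiBounds r =
  subst (λ w → suc w >φ* zvalFrom 1 r × suc w <φ* suc (zvalFrom 1 r)) (sym (zvalFrom-fib 0 r))
    (phiBounds-next (zvalFrom 1 r) (zvalFrom 0 r) (zvalFrom-phiBounds r))

zvalFrom₃-φ*-bracket : ∀ r →
  suc (zvalFrom 3 r) <φ* suc (zval r) × suc (suc (zvalFrom 3 r)) >φ* suc (zval r)
zvalFrom₃-φ*-bracket r =
    subst (λ w → suc w <φ* suc (zval r)) (sym z₃≡) (>φ*-flip (suc (zval r)) (zvalFrom 1 r) lo)
  , subst (_>φ* suc (zval r)) (cong suc (trans (+-suc (zval r) _) (cong suc (sym z₃≡))))
      (<φ*-flip (suc (zval r)) (suc (zvalFrom 1 r)) hi)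
  where
  open Σ (zvalFrom₂-phiBounds r) renaming (proj₁ to lo; proj₂ to hi)
  z₃≡ = zvalFrom-fib 1 r

isFloorPhiMul-zval : ∀ r → IsFloorPhiMul (suc (zval r)) (suc (zvalFrom 3 r))
isFloorPhiMul-zval r =
  uncurry (φ*-bracket⇒isFloorPhiMul (suc (zval r)) (suc (zvalFrom 3 r))) (zvalFrom₃-φ*-bracket r)

lowDigit-false : ∀ r → suc (zvalFrom 1 (false ∷ r)) <φ* suc (zvalFrom 0 (false ∷ r))
lowDigit-false r = proj₂ (zvalFrom₂-phiBounds r)

lowDigit-true : ∀ r → NoAdjacentOnes (true ∷ r) →
  suc (zvalFrom 1 (true ∷ r)) >φ* suc (zvalFrom 0 (true ∷ r))
lowDigit-true []          _ = ≤-refl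
lowDigit-true (false ∷ r) _ = proj₂ (zvalFrom₃-φ*-bracket r)

noAdjacentOnes-tail : ∀ b r → NoAdjacentOnes (b ∷ r) → NoAdjacentOnes r
noAdjacentOnes-tail false _ na = na
noAdjacentOnes-tail true [] na = na
noAdjacentOnes-tail true (false ∷ r) na = na

bval-unique₀₁ : ∀ r r' → NoAdjacentOnes r → NoAdjacentOnes r' →
  zvalFrom 1 r ≡ zvalFrom 1 r' → zvalFrom 0 r ≡ zvalFrom 0 r' → bval r ≡ bval r'
bval-unique₀₁ [] [] _ _ _ _ = refl
bval-unique₀₁ [] (true ∷ r') _ _ () _
bval-unique₀₁ (true ∷ r) [] _ _ () _
bval-unique₀₁ [] (false ∷ r') _ na' e₁ e₀ =
  cong (2 *_) (bval-unique₀₁ [] r' _ na' e₀ (zvalFrom-≡-down 0 [] r' e₁ e₀))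
bval-unique₀₁ (false ∷ r) [] na _ e₁ e₀ =
  cong (2 *_) (bval-unique₀₁ r [] na _ e₀ (zvalFrom-≡-down 0 r [] e₁ e₀))
bval-unique₀₁ (false ∷ r) (false ∷ r') na na' e₁ e₀ =
  cong (2 *_) (bval-unique₀₁ r r' na na' e₀ (zvalFrom-≡-down 0 r r' e₁ e₀))
bval-unique₀₁ (true ∷ r) (true ∷ r') na na' e₁ e₀ =
  cong (λ w → 1 + 2 * w) (bval-unique₀₁ r r'
    (noAdjacentOnes-tail true r na) (noAdjacentOnes-tail true r' na')
    e₀ (zvalFrom-≡-down 0 r r' (suc-injective e₁) e₀))
bval-unique₀₁ (true ∷ r) (false ∷ r') na _ e₁ e₀ = ⊥-elim (<-asym (lowDigit-true r na)
  (subst₂ (λ u v → suc u <φ* suc v) (sym e₁) (sym e₀) (lowDigit-false r')))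
bval-unique₀₁ (false ∷ r) (true ∷ r') na na' e₁ e₀ =
  sym (bval-unique₀₁ (true ∷ r') (false ∷ r) na' na (sym e₁) (sym e₀))

zeckendorf-bval-unique : ∀ r r' → NoAdjacentOnes r → NoAdjacentOnes r' →
  zval r ≡ zval r' → bval r ≡ bval r'
zeckendorf-bval-unique r r' na na' e₂ = bval-unique₀₁ r r' na na' e₁ e₀
  where
  e₃ : zvalFrom 3 r ≡ zvalFrom 3 r'
  e₃ = suc-injective (isFloorPhiMul-unique (isFloorPhiMul-zval r)
         (subst (λ m → IsFloorPhiMul (suc m) (suc (zvalFrom 3 r'))) (sym e₂) (isFloorPhiMul-zval r')))
  e₁ = zvalFrom-≡-down 1 r r' e₃ e₂
  e₀ = zvalFrom-≡-down 0 r r' e₂ e₁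

zvalFrom-replicate-false : ∀ j i l → zvalFrom i (replicate j false ++ l) ≡ zvalFrom (j + i) l
zvalFrom-replicate-false 0 i l = refl
zvalFrom-replicate-false (suc j) i l =
  trans (zvalFrom-replicate-false j (suc i) l) (cong (λ w → zvalFrom w l) (+-suc j i))

bval-replicate-false : ∀ j l → bval (replicate j false ++ l) ≡ 2 ^ j * bval l
bval-replicate-false 0 l = sym (+-identityʳ _)
bval-replicate-false (suc j) l =
  trans (cong (2 *_) (bval-replicate-false j l)) (sym (*-assoc 2 (2 ^ j) (bval l)))

noAdjacentOnes-replicate-false : ∀ j l → NoAdjacentOnes l → NoAdjacentOnes (replicate j false ++ l)
noAdjacentOnes-replicate-false 0 _ na = na
noAdjacentOnes-replicate-false (suc j) l na = noAdjacentOnes-replicate-false j l na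

wythoffDigits : ℕ → List Bool → List Bool
wythoffDigits k r = replicate k false ++ true ∷ false ∷ r

noAdjacentOnes-wythoffDigits : ∀ k r → NoAdjacentOnes r → NoAdjacentOnes (wythoffDigits k r)
noAdjacentOnes-wythoffDigits k r = noAdjacentOnes-replicate-false k (true ∷ false ∷ r)

zval-wythoffDigits : ∀ k r → zval (wythoffDigits k r) ≡ wythoffEntry (suc (zvalFrom 3 r)) (zval r) (suc k)
zval-wythoffDigits k r = begin
  zval (wythoffDigits k r)
    ≡⟨ zvalFrom-replicate-false k 2 _ ⟩
  zvalFrom (k + 2) (true ∷ false ∷ r)
    ≡⟨ cong (λ i → zvalFrom i (true ∷ false ∷ r)) (+-comm k 2) ⟩
  1 * F (2 + k) + zvalFrom (4 + k) r
    ≡⟨ cong (λ i → 1 * F (2 + k) + zvalFrom (suc i) r) (+-comm 3 k) ⟩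
  1 * F (2 + k) + zvalFrom (suc k + 3) r
    ≡⟨ cong (1 * F (2 + k) +_) (zvalFrom-shift (suc k) 2 r) ⟩
  1 * F (2 + k) + (F (2 + k) * zvalFrom 3 r + F (suc k) * zval r)
    ≡⟨ regroup (F (2 + k)) (F (suc k)) (zvalFrom 3 r) (zval r) ⟩
  suc (zvalFrom 3 r) * F (2 + k) + zval r * F (suc k)
    ∎
  where
  open ≡-Reasoning
  regroup : ∀ p q x y → 1 * p + (p * x + q * y) ≡ suc x * p + y * q
  regroup = solve-∀

bval-wythoffDigits : ∀ k r → bval (wythoffDigits k r) ≡ 2 ^ k * (4 * bval r + 1)
bval-wythoffDigits k r =
  trans (bval-replicate-false k _) (cong (2 ^ k *_) (regroup (bval r)))
  where
  regroup : ∀ x → 1 + 2 * (2 * x) ≡ 4 * x + 1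
  regroup = solve-∀

mainTheorem2 : (n k : ℕ) → 1 ≤ k → (a : ℕ) → IsFloorPhiMul (suc n) a →
    (ds es : List Bool) → IsZeckendorf (wythoffEntry a n k) ds → IsZeckendorf n es →
    bval ds ≡ 2 ^ (k ∸ 1) * (4 * bval es + 1)
mainTheorem2 n (suc k) _ a a-floor ds es (ds-na , ds-val) (es-na , refl) = begin
  bval ds                    ≡⟨ zeckendorf-bval-unique ds (wythoffDigits k es)
                                  ds-na (noAdjacentOnes-wythoffDigits k es es-na) same-value ⟩
  bval (wythoffDigits k es)  ≡⟨ bval-wythoffDigits k es ⟩
  2 ^ k * (4 * bval es + 1)  ∎
  where
  open ≡-Reasoning
  same-value : zval ds ≡ zval (wythoffDigits k es)
  same-value = begin
    zval ds                                               ≡⟨ ds-val ⟩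
    wythoffEntry a (zval es) (suc k)                      ≡⟨ cong (λ b → wythoffEntry b (zval es) (suc k))
                                                               (isFloorPhiMul-unique a-floor (isFloorPhiMul-zval es)) ⟩
    wythoffEntry (suc (zvalFrom 3 es)) (zval es) (suc k)  ≡⟨ zval-wythoffDigits k es ⟨
    zval (wythoffDigits k es)                             ∎
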